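{- Let $P$ and $Q$ be lattice paths from $(0,0)$ to $(m,r)$ with steps $E=(1,0)$, $N=(0,1)$, $P$ never going above $Q$, and view $\mathcal{M}[P,Q]$ as the transversal matroid on $\{1,\dots,m+r\}$ with presentation $(N_i:i\in\{1,\dots,r\})$, $N_i=[s_i,t_i]\cap\mathbb{Z}$, where $s_i$ and $t_i$ are the positions of the $i$-th North step of $Q$ and of $P$ respectively. Suppose there exist an integer $x$ and an index $1\le j\le r-1$ with $s_j<x<t_j$ and $s_{j+1}<x+1<t_{j+1}$. Then $\mathcal{P}(\mathcal{M}[P,Q])$ has a nontrivial hyperplane split; in fact there are lattice paths $P_1,Q_1$ from $(0,0)$ to $(m,r)$ such that this hyperplane split decomposes $\mathcal{P}(\mathcal{M}[P,Q])$ into the two lattice path matroid polytopes $\mathcal{P}(\mathcal{M}[P,Q_1])$ and $\mathcal{P}(\mathcal{M}[P_1,Q])$.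
   Context: $\mathcal{M}[P,Q]$ has as bases the $r$-subsets $B$ of $[m+r]$ such that the lattice path with North steps exactly at the positions in $B$ stays in the region bounded by $P$ and $Q$; $\mathcal{P}(\mathcal{M})=\mathrm{conv}\{\sum_{i\in B}e_i: B\text{ a basis}\}$. A matroid polytope decomposition of $\mathcal{P}(\mathcal{M})$ is an expression $\mathcal{P}(\mathcal{M})=\bigcup_{i=1}^t\mathcal{P}(\mathcal{M}_i)$ with each $\mathcal{M}_i$ a matroid, each $\mathcal{P}(\mathcal{M}_i)$ of the same dimension as $\mathcal{P}(\mathcal{M})$, and each pairwise intersection $\mathcal{P}(\mathcal{M}_i)\cap\mathcal{P}(\mathcal{M}_j)$ a face of both. A hyperplane split is such a decomposition with $t=2$; it is nontrivial if both pieces are proper subsets of $\mathcal{P}(\mathcal{M})$ (then their intersection is a common facet).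
   Formalization: The polytopes $\mathcal{P}(\mathcal{M}[P,Q])$, $\mathcal{P}(\mathcal{M}[P,Q_1])$ and $\mathcal{P}(\mathcal{M}[P_1,Q])$ are taken as sets of points with rational coordinates, and their faces, dimension and proper containment are taken over ℚ. -}

module Defs where

open import Data.Bool using (Bool; true; false; if_then_else_)
open import Data.Nat using (ℕ; zero; suc; _≤_) renaming (_+_ to _+ℕ_)
open import Data.Fin using (Fin; zero; suc)
open import Data.Vec using (Vec; []; _∷_; lookup)
open import Data.Rational using (ℚ; 0ℚ; 1ℚ; _+_; _*_) renaming (_≤_ to _≤ℚ_)
open import Data.Product using (Σ; ∃; _×_; _,_)
open import Data.Sum using (_⊎_)
open import Relation.Binary.PropositionalEquality using (_≡_)
open import Relation.Nullary using (¬_)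
open import Function.Bundles using (_⇔_)

-- Lattice paths from (0,0) to (m,r): a word of m+r steps, where
-- position k (1-indexed: k = 1 … m+r) is `true` iff the k-th step is
-- North N=(0,1), `false` iff it is East E=(1,0); exactly r North steps.

height : ∀ {n} → Vec Bool n → ℕ → ℕ
height []      k       = 0
height (b ∷ v) zero    = 0
height (b ∷ v) (suc k) = (if b then 1 else 0) +ℕ height v k

numN : ∀ {n} → Vec Bool n → ℕ
numN []      = 0
numN (b ∷ v) = (if b then 1 else 0) +ℕ numN v

Path : ℕ → ℕ → Set
Path m r = Σ (Vec Bool (m +ℕ r)) (λ v → numN v ≡ r)

NotAbove : ∀ {n} → Vec Bool n → Vec Bool n → Set
NotAbove P Q = ∀ k → height P k ≤ height Q k

-- (1-indexed) position of the i-th North step (i ≥ 1); 0 if there is none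
northPos : ∀ {n} → Vec Bool n → ℕ → ℕ
northPos v       zero          = 0
northPos []      (suc i)       = 0
northPos (true  ∷ v) (suc zero)    = 1
northPos (true  ∷ v) (suc (suc i)) = suc (northPos v (suc i))
northPos (false ∷ v) (suc i)       = suc (northPos v (suc i))

-- Bases of M[P,Q]: r-subsets B of [m+r] (encoded as the lattice path with
-- North steps exactly at the positions in B) staying between P and Q.
IsBasis : ∀ {m r} → Path m r → Path m r → Vec Bool (m +ℕ r) → Set
IsBasis {m} {r} (P , _) (Q , _) B = (numN B ≡ r) × NotAbove P B × NotAbove B Q

Point : ℕ → Set
Point n = Fin n → ℚ

PointSet : ℕ → Set₁
PointSet n = Point n → Set

sumℚ : ∀ {k} → (Fin k → ℚ) → ℚ
sumℚ {zero}  f = 0ℚ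
sumℚ {suc k} f = f zero + sumℚ (λ i → f (suc i))

indicator : ∀ {n} → Vec Bool n → Point n
indicator B i = if lookup B i then 1ℚ else 0ℚ

LPMPolytope : ∀ {m r} → Path m r → Path m r → PointSet (m +ℕ r)
LPMPolytope {m} {r} P Q x =
  Σ ℕ λ k → Σ (Fin k → Vec Bool (m +ℕ r)) λ Bs → Σ (Fin k → ℚ) λ λs →
    (∀ l → IsBasis P Q (Bs l)) ×
    (∀ l → 0ℚ ≤ℚ λs l) ×
    (sumℚ λs ≡ 1ℚ) ×
    (∀ i → x i ≡ sumℚ (λ l → λs l * indicator (Bs l) i))

dot : ∀ {n} → Point n → Point n → ℚ
dot c x = sumℚ (λ i → c i * x i)

_≐_ : ∀ {n} → PointSet n → PointSet n → Set
S ≐ T = ∀ x → S x ⇔ T x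

IsFace : ∀ {n} → PointSet n → PointSet n → Set
IsFace {n} F S = Σ (Point n) λ c → Σ ℚ λ b →
  (∀ x → S x → dot c x ≤ℚ b) × (F ≐ (λ x → S x × (dot c x ≡ b)))

AffIndep : ∀ {n k} → (Fin (suc k) → Point n) → Set
AffIndep {n} {k} p = ∀ (μ : Fin (suc k) → ℚ) → sumℚ μ ≡ 0ℚ →
  (∀ i → sumℚ (λ l → μ l * p l i) ≡ 0ℚ) → ∀ l → μ l ≡ 0ℚ

-- S contains k+1 affinely independent points (i.e. dim S ≥ k)
HasAffIndep : ∀ {n} → PointSet n → ℕ → Set
HasAffIndep {n} S k = Σ (Fin (suc k) → Point n) λ p → (∀ l → S (p l)) × AffIndep p

SameDim : ∀ {n} → PointSet n → PointSet n → Set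
SameDim S T = ∀ k → HasAffIndep S k ⇔ HasAffIndep T k

_∩_ : ∀ {n} → PointSet n → PointSet n → PointSet n
(S ∩ T) x = S x × T x

HyperplaneSplit : ∀ {n} → PointSet n → PointSet n → PointSet n → Set
HyperplaneSplit S S₁ S₂ =
  (S ≐ (λ x → S₁ x ⊎ S₂ x)) ×
  SameDim S₁ S × SameDim S₂ S ×
  IsFace (S₁ ∩ S₂) S₁ × IsFace (S₁ ∩ S₂) S₂

ProperSubset : ∀ {n} → PointSet n → PointSet n → Set
ProperSubset T S = Σ _ λ x → S x × ¬ T x

NontrivialHyperplaneSplit : ∀ {n} → PointSet n → PointSet n → PointSet n → Set
NontrivialHyperplaneSplit S S₁ S₂ =
  HyperplaneSplit S S₁ S₂ × ProperSubset S₁ S × ProperSubset S₂ S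

-- Present a point y of P(M[P,Q]) as Σ_l (c_l/D)·e_{B_l} with integer weights
-- c_l summing to D; its profile A(k) = Σ_l c_l·height(B_l,k) satisfies
-- y_1 + … + y_k = A(k)/D.  Rounding theorem: if D·height(P') ≤ A ≤ D·height(Q'),
-- then y ∈ P(M[P',Q']), since the D paths with heights ⌊(A+t)/D⌋ (t < D) are
-- bases of M[P',Q'] averaging to y by Hermite's identity Σ_{t<D} ⌊(a+t)/D⌋ = a.
-- Put Q₁ = min(Q, j + (k ∸ x)) and P₁ = max(P, j ∸ (x ∸ k)).  As A grows by at
-- most D per step, A(x) ≤ jD gives A ≤ D·Q₁ and A(x) ≥ jD gives A ≥ D·P₁; so in
-- P(M[P,Q]) the pieces P(M[P,Q₁]), P(M[P₁,Q]) are the half-spaces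
-- y_1 + … + y_x ≤ j and ≥ j, and a general half-space lemma yields the cover
-- and the common face.  The contraction y ↦ (n·e_P + y)/(n+1) (resp. e_Q) maps
-- P(M[P,Q]) into each piece, so dimensions agree; e_Q and e_P show properness.
module Submission where

open import Defs
open import Data.Nat using (ℕ; _≤_; _<_; _∸_) renaming (_+_ to _+ℕ_)
open import Data.Integer using (ℤ; +_) renaming (_<_ to _<ℤ_; _+_ to _+ℤ_)
open import Data.Product using (Σ; _×_; proj₁)

open import Data.Bool using (Bool; true; false; if_then_else_; not; T)
open import Data.Nat as ℕ using (zero; suc; z≤n; s≤s; _⊓_; _⊔_) renaming (_*_ to _*ℕ_)
import Data.Nat.Properties as ℕP
open import Data.Nat.DivMod using (_/_)
import Data.Nat.DivMod as ℕD
open import Data.Nat.Divisibility using (n∣m*n)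
open import Data.Nat.Tactic.RingSolver using (solve-∀)
open import Data.Integer as ℤ using (-[1+_])
import Data.Integer.Properties as ℤP
open import Data.Rational as ℚ using (ℚ; 0ℚ; 1ℚ; _+_; _*_; -_; mkℚ; toℚᵘ) renaming (_≤_ to _≤ℚ_)
import Data.Rational.Properties as ℚP
import Data.Rational.Unnormalised as ℚᵘ
import Data.Rational.Unnormalised.Properties as ℚᵘP
import Data.Rational.Solver as ℚSolver
open import Data.Fin using (Fin; zero; suc; toℕ; inject₁; fromℕ)
import Data.Fin.Properties as FinP
open import Data.Vec using (Vec; []; _∷_; lookup)
open import Data.Product using (_,_; proj₂)
open import Data.Sum using (_⊎_; inj₁; inj₂)
open import Data.Empty using (⊥-elim)
open import Relation.Binary.PropositionalEquality
open import Function.Bundles using (_⇔_; mk⇔; Equivalence)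
import Algebra.Properties.Semiring.Sum as SemiringSum
import Algebra.Properties.Ring as RingProperties
open import Algebra.Bundles using (Ring)

module ΣN = SemiringSum ℕP.+-*-semiring
module ΣQ = SemiringSum (Ring.semiring ℚP.+-*-ring)
open RingProperties ℚP.+-*-ring using (-‿distribˡ-*)

-- Non-negative fractions a/(d+1)

frac : ℕ → ℕ → ℚ
frac a d = (+ a) ℚ./ suc d

frac-toℚᵘ : ∀ a d → toℚᵘ (frac a d) ℚᵘ.≃ ℚᵘ.mkℚᵘ (+ a) d
frac-toℚᵘ a d = ℚP.toℚᵘ-fromℚᵘ (ℚᵘ.mkℚᵘ (+ a) d)

frac-cong : ∀ a d b e → a *ℕ suc e ≡ b *ℕ suc d → frac a d ≡ frac b e
frac-cong a d b e eq = ℚP.toℚᵘ-injective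
  (ℚᵘP.≃-trans (frac-toℚᵘ a d) (ℚᵘP.≃-trans (ℚᵘ.*≡* cross) (ℚᵘP.≃-sym (frac-toℚᵘ b e))))
  where
  cross : + a ℤ.* + suc e ≡ + b ℤ.* + suc d
  cross = trans (sym (ℤP.pos-* a (suc e))) (trans (cong +_ eq) (ℤP.pos-* b (suc d)))

frac-cross : ∀ a d b e → frac a d ≡ frac b e → a *ℕ suc e ≡ b *ℕ suc d
frac-cross a d b e eq
  with ℚᵘP.≃-trans (ℚᵘP.≃-sym (frac-toℚᵘ a d)) (ℚᵘP.≃-trans (ℚP.toℚᵘ-cong eq) (frac-toℚᵘ b e))
... | ℚᵘ.*≡* p = ℤP.+-injective (trans (ℤP.pos-* a (suc e)) (trans p (sym (ℤP.pos-* b (suc d)))))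

frac-mono : ∀ a d b e → a *ℕ suc e ≤ b *ℕ suc d → frac a d ≤ℚ frac b e
frac-mono a d b e le = ℚP.toℚᵘ-cancel-≤
  (ℚᵘP.≤-respʳ-≃ (ℚᵘP.≃-sym (frac-toℚᵘ b e)) (ℚᵘP.≤-respˡ-≃ (ℚᵘP.≃-sym (frac-toℚᵘ a d))
    (ℚᵘ.*≤* (subst₂ ℤ._≤_ (ℤP.pos-* a (suc e)) (ℤP.pos-* b (suc d)) (ℤ.+≤+ le)))))

frac-mono⁻¹ : ∀ a d b e → frac a d ≤ℚ frac b e → a *ℕ suc e ≤ b *ℕ suc d
frac-mono⁻¹ a d b e le
  with ℚᵘP.≤-respʳ-≃ (frac-toℚᵘ b e) (ℚᵘP.≤-respˡ-≃ (frac-toℚᵘ a d) (ℚP.toℚᵘ-mono-≤ le))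
... | ℚᵘ.*≤* p = ℤP.drop‿+≤+ (subst₂ ℤ._≤_ (sym (ℤP.pos-* a (suc e))) (sym (ℤP.pos-* b (suc d))) p)

frac-+ : ∀ a d b e → frac a d + frac b e ≡ frac (a *ℕ suc e +ℕ b *ℕ suc d) (e +ℕ d *ℕ suc e)
frac-+ a d b e = ℚP.toℚᵘ-injective
  (ℚᵘP.≃-trans (ℚP.toℚᵘ-homo-+ (frac a d) (frac b e))
  (ℚᵘP.≃-trans (ℚᵘP.+-cong (frac-toℚᵘ a d) (frac-toℚᵘ b e))
  (ℚᵘP.≃-trans (ℚᵘ.*≡* (cong (ℤ._* (+ suc (e +ℕ d *ℕ suc e))) numerator))
  (ℚᵘP.≃-sym (frac-toℚᵘ (a *ℕ suc e +ℕ b *ℕ suc d) (e +ℕ d *ℕ suc e))))))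
  where
  numerator : + a ℤ.* + suc e ℤ.+ + b ℤ.* + suc d ≡ + (a *ℕ suc e +ℕ b *ℕ suc d)
  numerator = trans (cong₂ ℤ._+_ (sym (ℤP.pos-* a (suc e))) (sym (ℤP.pos-* b (suc d))))
    (sym (ℤP.pos-+ (a *ℕ suc e) (b *ℕ suc d)))

frac-* : ∀ a d b e → frac a d * frac b e ≡ frac (a *ℕ b) (e +ℕ d *ℕ suc e)
frac-* a d b e = ℚP.toℚᵘ-injective
  (ℚᵘP.≃-trans (ℚP.toℚᵘ-homo-* (frac a d) (frac b e))
  (ℚᵘP.≃-trans (ℚᵘP.*-cong (frac-toℚᵘ a d) (frac-toℚᵘ b e))
  (ℚᵘP.≃-trans (ℚᵘ.*≡* (cong (ℤ._* (+ suc (e +ℕ d *ℕ suc e))) (sym (ℤP.pos-* a b))))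
  (ℚᵘP.≃-sym (frac-toℚᵘ (a *ℕ b) (e +ℕ d *ℕ suc e))))))

frac-≤-integer : ∀ a d j → frac a d ≤ℚ frac j 0 ⇔ a ≤ j *ℕ suc d
frac-≤-integer a d j = mk⇔
  (λ le → subst (_≤ j *ℕ suc d) (ℕP.*-identityʳ a) (frac-mono⁻¹ a d j 0 le))
  (λ le → frac-mono a d j 0 (subst (_≤ j *ℕ suc d) (sym (ℕP.*-identityʳ a)) le))

integer-≤-frac : ∀ j a d → frac j 0 ≤ℚ frac a d ⇔ j *ℕ suc d ≤ a
integer-≤-frac j a d = mk⇔
  (λ le → subst (j *ℕ suc d ≤_) (ℕP.*-identityʳ a) (frac-mono⁻¹ j 0 a d le))
  (λ le → frac-mono j 0 a d (subst (j *ℕ suc d ≤_) (sym (ℕP.*-identityʳ a)) le))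

frac-*-integer : ∀ a d b → frac a d * frac b 0 ≡ frac (a *ℕ b) d
frac-*-integer a d b = trans (frac-* a d b 0)
  (frac-cong (a *ℕ b) (0 +ℕ d *ℕ 1) (a *ℕ b) d (cong (λ z → a *ℕ b *ℕ suc z) (sym (ℕP.*-identityʳ d))))

frac-zero : ∀ d → frac 0 d ≡ 0ℚ
frac-zero d = frac-cong 0 d 0 0 refl

nonneg⇒frac : ∀ q → 0ℚ ≤ℚ q → Σ ℕ λ a → Σ ℕ λ d → q ≡ frac a d
nonneg⇒frac (mkℚ (+ a) d c) le = a , d , sym (ℚP.↥p/↧p≡p (mkℚ (+ a) d c))
nonneg⇒frac (mkℚ -[1+ a ] d c) (ℚ.*≤* ())

sumℚ≡sum : ∀ {k} (f : Fin k → ℚ) → sumℚ f ≡ ΣQ.sum f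
sumℚ≡sum {zero}  f = refl
sumℚ≡sum {suc k} f = cong (λ z → f zero + z) (sumℚ≡sum (λ l → f (suc l)))

sumℚ-cong : ∀ {k} {f g : Fin k → ℚ} → (∀ l → f l ≡ g l) → sumℚ f ≡ sumℚ g
sumℚ-cong {f = f} {g} eq = trans (sumℚ≡sum f) (trans (ΣQ.sum-cong-≗ eq) (sym (sumℚ≡sum g)))

sumℚ-+ : ∀ {k} (f g : Fin k → ℚ) → sumℚ (λ l → f l + g l) ≡ sumℚ f + sumℚ g
sumℚ-+ f g = trans (sumℚ≡sum (λ l → f l + g l)) (trans (ΣQ.∑-distrib-+ f g)
  (sym (cong₂ _+_ (sumℚ≡sum f) (sumℚ≡sum g))))

sumℚ-*ˡ : ∀ {k} a (f : Fin k → ℚ) → sumℚ (λ l → a * f l) ≡ a * sumℚ f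
sumℚ-*ˡ a f = trans (sumℚ≡sum (λ l → a * f l)) (trans (sym (ΣQ.*-distribˡ-sum a f)) (cong (a *_) (sym (sumℚ≡sum f))))

sumℚ-frac : ∀ {k} d (f : Fin k → ℕ) → sumℚ (λ l → frac (f l) d) ≡ frac (ΣN.sum f) d
sumℚ-frac {zero}  d f = sym (frac-zero d)
sumℚ-frac {suc k} d f = begin
  frac a d + sumℚ (λ l → frac (f (suc l)) d) ≡⟨ cong (λ z → frac a d + z) (sumℚ-frac d (λ l → f (suc l))) ⟩
  frac a d + frac s d                         ≡⟨ frac-+ a d s d ⟩
  frac (a *ℕ suc d +ℕ s *ℕ suc d) (d +ℕ d *ℕ suc d)
    ≡⟨ frac-cong (a *ℕ suc d +ℕ s *ℕ suc d) (d +ℕ d *ℕ suc d) (a +ℕ s) d (common a s (suc d)) ⟩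
  frac (a +ℕ s) d                             ∎
  where
  open ≡-Reasoning
  a = f zero
  s = ΣN.sum (λ l → f (suc l))
  common : ∀ a b D → (a *ℕ D +ℕ b *ℕ D) *ℕ D ≡ (a +ℕ b) *ℕ (D *ℕ D)
  common = solve-∀

sumN-mono : ∀ {k} {f g : Fin k → ℕ} → (∀ l → f l ≤ g l) → ΣN.sum f ≤ ΣN.sum g
sumN-mono {zero}  le = z≤n
sumN-mono {suc k} le = ℕP.+-mono-≤ (le zero) (sumN-mono (λ l → le (suc l)))

sumN-*const : ∀ {k} (c : Fin k → ℕ) v → ΣN.sum (λ l → c l *ℕ v) ≡ v *ℕ ΣN.sum c
sumN-*const c v = trans (sym (ΣN.*-distribʳ-sum v c)) (ℕP.*-comm (ΣN.sum c) v)

dot-neg : ∀ {n} (c y : Point n) → dot (λ i → - c i) y ≡ - dot c y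
dot-neg {zero}  c y = refl
dot-neg {suc n} c y = begin
  - c zero * y zero + dot (λ i → - c (suc i)) (λ i → y (suc i))
    ≡⟨ cong₂ _+_ (sym (-‿distribˡ-* (c zero) (y zero))) (dot-neg (λ i → c (suc i)) (λ i → y (suc i))) ⟩
  - (c zero * y zero) + - dot (λ i → c (suc i)) (λ i → y (suc i))
    ≡⟨ sym (ℚP.neg-distrib-+ (c zero * y zero) _) ⟩
  - dot c y ∎
  where open ≡-Reasoning

-- Splitting a point set by a hyperplane

-- If S₁ and S₂ are the parts of S on the two sides of the hyperplane
-- c·y = b, they cover S and their intersection is a face of each: it is
-- cut out of S₁ by c·y ≤ b and out of S₂ by (−c)·y ≤ −b.
module HalfSpaceSplit {n} (S S₁ S₂ : PointSet n) (c : Point n) (b : ℚ)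
  (below : ∀ y → S₁ y ⇔ (S y × dot c y ≤ℚ b))
  (above : ∀ y → S₂ y ⇔ (S y × b ≤ℚ dot c y)) where

  open Equivalence

  covers : S ≐ (λ y → S₁ y ⊎ S₂ y)
  covers y = mk⇔ split (λ { (inj₁ s₁) → proj₁ (to (below y) s₁) ; (inj₂ s₂) → proj₁ (to (above y) s₂) })
    where
    split : S y → S₁ y ⊎ S₂ y
    split s with ℚP.≤-total (dot c y) b
    ... | inj₁ le = inj₁ (from (below y) (s , le))
    ... | inj₂ ge = inj₂ (from (above y) (s , ge))

  on-hyperplane : ∀ {y} → S₁ y → S₂ y → dot c y ≡ b
  on-hyperplane {y} s₁ s₂ = ℚP.≤-antisym (proj₂ (to (below y) s₁)) (proj₂ (to (above y) s₂))

  face-below : IsFace (S₁ ∩ S₂) S₁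
  face-below = c , b , (λ y s₁ → proj₂ (to (below y) s₁)) ,
    λ y → mk⇔ (λ { (s₁ , s₂) → s₁ , on-hyperplane s₁ s₂ })
              (λ { (s₁ , eq) → s₁ , from (above y) (proj₁ (to (below y) s₁) , ℚP.≤-reflexive (sym eq)) })

  face-above : IsFace (S₁ ∩ S₂) S₂
  face-above = (λ i → - c i) , - b ,
    (λ y s₂ → subst (_≤ℚ - b) (sym (dot-neg c y)) (ℚP.neg-antimono-≤ (proj₂ (to (above y) s₂)))) ,
    λ y → mk⇔ (λ { (s₁ , s₂) → s₂ , trans (dot-neg c y) (cong -_ (on-hyperplane s₁ s₂)) })
              (λ { (s₂ , eq) → from (below y) (proj₁ (to (above y) s₂) , ℚP.≤-reflexive (negated eq)) , s₂ })
    where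
    negated : ∀ {y} → dot (λ i → - c i) y ≡ - b → dot c y ≡ b
    negated {y} eq = ℚP.neg-injective (trans (sym (dot-neg c y)) eq)

contraction-affIndep : ∀ {n k} (e : Point n) (α ε ε⁻¹ : ℚ) → ε⁻¹ * ε ≡ 1ℚ →
  (p : Fin (suc k) → Point n) → AffIndep p → AffIndep (λ l i → α * e i + ε * p l i)
contraction-affIndep e α ε ε⁻¹ inv p indep μ Σμ≡0 image≡0 = indep μ Σμ≡0 original≡0
  where
  distribute : ∀ μ a ε p → μ * (a + ε * p) ≡ a * μ + ε * (μ * p)
  distribute = ℚSolver.+-*-Solver.solve 4
    (λ μ a ε p → μ :* (a :+ ε :* p) := a :* μ :+ ε :* (μ :* p)) refl
    where open ℚSolver.+-*-Solver
  original≡0 : ∀ i → sumℚ (λ l → μ l * p l i) ≡ 0ℚ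
  original≡0 i = begin
    S                 ≡⟨ sym (ℚP.*-identityˡ S) ⟩
    1ℚ * S            ≡⟨ cong (_* S) (sym inv) ⟩
    (ε⁻¹ * ε) * S     ≡⟨ ℚP.*-assoc ε⁻¹ ε S ⟩
    ε⁻¹ * (ε * S)     ≡⟨ cong (ε⁻¹ *_) εS≡0 ⟩
    ε⁻¹ * 0ℚ          ≡⟨ ℚP.*-zeroʳ ε⁻¹ ⟩
    0ℚ                ∎
    where
    open ≡-Reasoning
    a = α * e i
    S = sumℚ (λ l → μ l * p l i)
    εS≡0 : ε * S ≡ 0ℚ
    εS≡0 = begin
      ε * S                                          ≡⟨ sym (ℚP.+-identityˡ (ε * S)) ⟩
      0ℚ + ε * S                                     ≡⟨ cong (_+ ε * S) (sym (trans (cong (a *_) Σμ≡0) (ℚP.*-zeroʳ a))) ⟩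
      a * sumℚ μ + ε * S                             ≡⟨ cong₂ _+_ (sym (sumℚ-*ˡ a μ)) (sym (sumℚ-*ˡ ε (λ l → μ l * p l i))) ⟩
      sumℚ (λ l → a * μ l) + sumℚ (λ l → ε * (μ l * p l i)) ≡⟨ sym (sumℚ-+ (λ l → a * μ l) (λ l → ε * (μ l * p l i))) ⟩
      sumℚ (λ l → a * μ l + ε * (μ l * p l i))       ≡⟨ sumℚ-cong (λ l → sym (distribute (μ l) a ε (p l i))) ⟩
      sumℚ (λ l → μ l * (a + ε * p l i))             ≡⟨ image≡0 i ⟩
      0ℚ                                             ∎

sameDim-byContraction : ∀ {n} (S T : PointSet n) (e : Point n) (α ε ε⁻¹ : ℚ) → ε⁻¹ * ε ≡ 1ℚ →
  (∀ y → T y → S y) → (∀ y → S y → T (λ i → α * e i + ε * y i)) → SameDim T S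
sameDim-byContraction S T e α ε ε⁻¹ inv T⊆S contract k =
  mk⇔ (λ { (p , inT , indep) → p , (λ l → T⊆S (p l) (inT l)) , indep })
      (λ { (p , inS , indep) → (λ l i → α * e i + ε * p l i) , (λ l → contract (p l) (inS l)) ,
                               contraction-affIndep e α ε ε⁻¹ inv p indep })

-- Height functions of lattice paths

-- f is weakly increasing with increments at most one: the shape of the
-- height function of a lattice path
UnitStep : (ℕ → ℕ) → Set
UnitStep f = ∀ k → f k ≤ f (suc k) × f (suc k) ≤ suc (f k)

unitStep-mono : ∀ {f} → UnitStep f → ∀ {k l} → k ≤ l → f k ≤ f l
unitStep-mono {f} st {k} {l} k≤l = subst (λ z → f k ≤ f z) (ℕP.m∸n+n≡m k≤l) (climb (l ∸ k))
  where
  climb : ∀ t → f k ≤ f (t +ℕ k)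
  climb zero    = ℕP.≤-refl
  climb (suc t) = ℕP.≤-trans (climb t) (proj₁ (st (t +ℕ k)))

unitStep-lipschitz : ∀ {f} → UnitStep f → ∀ k l → f l ≤ f k +ℕ (l ∸ k)
unitStep-lipschitz {f} st k l with ℕP.≤-total k l
... | inj₂ l≤k = ℕP.≤-trans (unitStep-mono st l≤k) (ℕP.m≤m+n (f k) (l ∸ k))
... | inj₁ k≤l = subst (λ z → f z ≤ f k +ℕ (l ∸ k)) (ℕP.m∸n+n≡m k≤l) (climb (l ∸ k))
  where
  climb : ∀ t → f (t +ℕ k) ≤ f k +ℕ t
  climb zero    = ℕP.≤-reflexive (sym (ℕP.+-identityʳ (f k)))
  climb (suc t) = ℕP.≤-trans (proj₂ (st (t +ℕ k)))
    (subst (suc (f (t +ℕ k)) ≤_) (sym (ℕP.+-suc (f k) t)) (s≤s (climb t)))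

unitStep-⊓ : ∀ {f g} → UnitStep f → UnitStep g → UnitStep (λ k → f k ⊓ g k)
unitStep-⊓ sf sg k = ℕP.⊓-mono-≤ (proj₁ (sf k)) (proj₁ (sg k)) , ℕP.⊓-mono-≤ (proj₂ (sf k)) (proj₂ (sg k))

unitStep-⊔ : ∀ {f g} → UnitStep f → UnitStep g → UnitStep (λ k → f k ⊔ g k)
unitStep-⊔ sf sg k = ℕP.⊔-mono-≤ (proj₁ (sf k)) (proj₁ (sg k)) , ℕP.⊔-mono-≤ (proj₂ (sf k)) (proj₂ (sg k))

unitStep-rise : ∀ j x → UnitStep (λ k → j +ℕ (k ∸ x))
unitStep-rise j x k = ℕP.+-monoʳ-≤ j (proj₁ (rise x k)) ,
  ℕP.≤-trans (ℕP.+-monoʳ-≤ j (proj₂ (rise x k))) (ℕP.≤-reflexive (ℕP.+-suc j _))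
  where
  rise : ∀ x → UnitStep (λ k → k ∸ x)
  rise zero    k       = ℕP.n≤1+n k , ℕP.≤-refl
  rise (suc x) zero    = z≤n , ℕP.≤-trans (ℕP.≤-reflexive (ℕP.0∸n≡0 x)) z≤n
  rise (suc x) (suc k) = rise x k

unitStep-reach : ∀ j x → UnitStep (λ k → j ∸ (x ∸ k))
unitStep-reach j x k = truncate j (x ∸ k) (x ∸ suc k) (proj₁ (countdown x k)) (proj₂ (countdown x k))
  where
  countdown : ∀ x k → x ∸ suc k ≤ x ∸ k × x ∸ k ≤ suc (x ∸ suc k)
  countdown zero    zero    = z≤n , z≤n
  countdown zero    (suc k) = z≤n , z≤n
  countdown (suc x) zero    = ℕP.n≤1+n x , ℕP.≤-refl
  countdown (suc x) (suc k) = countdown x k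
  truncate : ∀ j a b → b ≤ a → a ≤ suc b → j ∸ a ≤ j ∸ b × j ∸ b ≤ suc (j ∸ a)
  truncate zero    a             b       _         _         =
    ℕP.≤-reflexive (trans (ℕP.0∸n≡0 a) (sym (ℕP.0∸n≡0 b))) , ℕP.≤-trans (ℕP.≤-reflexive (ℕP.0∸n≡0 b)) z≤n
  truncate (suc j) zero          zero    _         _         = ℕP.≤-refl , ℕP.n≤1+n _
  truncate (suc j) (suc zero)    zero    _         _         = ℕP.n≤1+n j , ℕP.≤-refl
  truncate (suc j) (suc (suc a)) zero    _         (s≤s ())
  truncate (suc j) (suc a)       (suc b) (s≤s b≤a) (s≤s a≤b+1) = truncate j a b b≤a a≤b+1

height-zero : ∀ {n} (v : Vec Bool n) → height v 0 ≡ 0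
height-zero []      = refl
height-zero (b ∷ v) = refl

height-unitStep : ∀ {n} (v : Vec Bool n) → UnitStep (height v)
height-unitStep []          k       = z≤n , z≤n
height-unitStep (true ∷ v)  zero    = z≤n , s≤s (ℕP.≤-reflexive (height-zero v))
height-unitStep (false ∷ v) zero    = z≤n , ℕP.≤-trans (ℕP.≤-reflexive (height-zero v)) z≤n
height-unitStep (true ∷ v)  (suc k) = s≤s (proj₁ (height-unitStep v k)) , s≤s (proj₂ (height-unitStep v k))
height-unitStep (false ∷ v) (suc k) = height-unitStep v k

height-≤-steps : ∀ {n} (v : Vec Bool n) k → height v k ≤ k
height-≤-steps []          k       = z≤n
height-≤-steps (b ∷ v)     zero    = z≤n
height-≤-steps (true ∷ v)  (suc k) = s≤s (height-≤-steps v k)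
height-≤-steps (false ∷ v) (suc k) = ℕP.m≤n⇒m≤1+n (height-≤-steps v k)

height-end : ∀ {n} (v : Vec Bool n) k → n ≤ k → height v k ≡ numN v
height-end []          k       _         = refl
height-end (true ∷ v)  (suc k) (s≤s n≤k) = cong suc (height-end v k n≤k)
height-end (false ∷ v) (suc k) (s≤s n≤k) = height-end v k n≤k

height-⊓ : ∀ {n} (v : Vec Bool n) k → height v k ≡ height v (k ⊓ n)
height-⊓ {n} v k with ℕP.≤-total k n
... | inj₁ k≤n = cong (height v) (sym (ℕP.m≤n⇒m⊓n≡m k≤n))
... | inj₂ n≤k = trans (height-end v k n≤k)
  (sym (height-end v (k ⊓ n) (ℕP.≤-reflexive (sym (ℕP.m≥n⇒m⊓n≡n n≤k)))))

height-≤-numN : ∀ {n} (v : Vec Bool n) k → height v k ≤ numN v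
height-≤-numN {n} v k = ℕP.≤-trans (ℕP.≤-reflexive (height-⊓ v k))
  (ℕP.≤-trans (unitStep-mono (height-unitStep v) (ℕP.m⊓n≤n k n)) (ℕP.≤-reflexive (height-end v n ℕP.≤-refl)))

bit : Bool → ℕ
bit true  = 1
bit false = 0

-- the step at (0-indexed) position i raises the height by bit (v i)
height-step : ∀ {n} (v : Vec Bool n) (i : Fin n) →
  height v (suc (toℕ i)) ≡ bit (lookup v i) +ℕ height v (toℕ i)
height-step (true ∷ v)  zero    = cong suc (height-zero v)
height-step (false ∷ v) zero    = height-zero v
height-step (true ∷ v)  (suc i) = trans (cong suc (height-step v i)) (sym (ℕP.+-suc (bit (lookup v i)) _))
height-step (false ∷ v) (suc i) = height-step v i

northPos-reached : ∀ {n} (v : Vec Bool n) i → 1 ≤ i → i ≤ numN v → i ≤ height v (northPos v i)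
northPos-reached []          (suc i)       _ ()
northPos-reached (true ∷ v)  (suc zero)    _ _         = s≤s z≤n
northPos-reached (true ∷ v)  (suc (suc i)) _ (s≤s le)  = s≤s (northPos-reached v (suc i) (s≤s z≤n) le)
northPos-reached (false ∷ v) (suc i)       _ le        = northPos-reached v (suc i) (s≤s z≤n) le

northPos-first : ∀ {n} (v : Vec Bool n) i k → 1 ≤ i → i ≤ height v k → northPos v i ≤ k
northPos-first []          (suc i)       k       _ ()
northPos-first (b ∷ v)     (suc i)       zero    _ ()
northPos-first (true ∷ v)  (suc zero)    (suc k) _ _        = s≤s z≤n
northPos-first (true ∷ v)  (suc (suc i)) (suc k) _ (s≤s le) = s≤s (northPos-first v (suc i) k (s≤s z≤n) le)
northPos-first (false ∷ v) (suc i)       (suc k) _ le       = s≤s (northPos-first v (suc i) k (s≤s z≤n) le)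

wordOf : (ℕ → ℕ) → ℕ → (n : ℕ) → Vec Bool n
wordOf g i zero    = []
wordOf g i (suc n) = not (g (suc i) ℕ.≡ᵇ g i) ∷ wordOf g (suc i) n

wordOf-step : ∀ {g} → UnitStep g → ∀ i → (if not (g (suc i) ℕ.≡ᵇ g i) then 1 else 0) +ℕ g i ≡ g (suc i)
wordOf-step {g} st i with g (suc i) ℕ.≡ᵇ g i in eq
... | true  = sym (ℕP.≡ᵇ⇒≡ (g (suc i)) (g i) (subst T (sym eq) _))
... | false with ℕP.m≤n⇒m<n∨m≡n (proj₂ (st i))
...   | inj₂ rises        = sym rises
...   | inj₁ (s≤s stays) =
  ⊥-elim (subst T eq (ℕP.≡⇒≡ᵇ (g (suc i)) (g i) (ℕP.≤-antisym stays (proj₁ (st i)))))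

wordOf-height : ∀ {g} → UnitStep g → ∀ i n k → k ≤ n → height (wordOf g i n) k +ℕ g i ≡ g (k +ℕ i)
wordOf-height {g} st i n       zero    _         = cong (_+ℕ g i) (height-zero (wordOf g i n))
wordOf-height {g} st i (suc n) (suc k) (s≤s k≤n) = begin
  (b +ℕ H) +ℕ g i   ≡⟨ regroup b H (g i) ⟩
  (b +ℕ g i) +ℕ H   ≡⟨ cong (_+ℕ H) (wordOf-step st i) ⟩
  g (suc i) +ℕ H    ≡⟨ ℕP.+-comm (g (suc i)) H ⟩
  H +ℕ g (suc i)    ≡⟨ wordOf-height st (suc i) n k k≤n ⟩
  g (k +ℕ suc i)    ≡⟨ cong g (ℕP.+-suc k i) ⟩
  g (suc k +ℕ i)    ∎
  where
  open ≡-Reasoning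
  b = if not (g (suc i) ℕ.≡ᵇ g i) then 1 else 0
  H = height (wordOf g (suc i) n) k
  regroup : ∀ a b c → (a +ℕ b) +ℕ c ≡ (a +ℕ c) +ℕ b
  regroup = solve-∀

pathWithHeights : ∀ m r (g : ℕ → ℕ) → g 0 ≡ 0 → UnitStep g → g (m +ℕ r) ≡ r →
  Σ (Path m r) λ L → ∀ k → height (proj₁ L) k ≡ g (k ⊓ (m +ℕ r))
pathWithHeights m r g g0 st gend = (v , numN-v) , heights
  where
  n = m +ℕ r
  v = wordOf g 0 n
  inRange : ∀ k → k ≤ n → height v k ≡ g k
  inRange k k≤n = trans (sym (ℕP.+-identityʳ _)) (trans (cong (height v k +ℕ_) (sym g0))
    (trans (wordOf-height st 0 n k k≤n) (cong g (ℕP.+-identityʳ k))))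
  numN-v : numN v ≡ r
  numN-v = trans (sym (height-end v n ℕP.≤-refl)) (trans (inRange n ℕP.≤-refl) gend)
  heights : ∀ k → height v k ≡ g (k ⊓ n)
  heights k = trans (height-⊓ v k) (inRange (k ⊓ n) (ℕP.m⊓n≤n k n))

-- Hermite's identity  Σ_{t<D} ⌊(a+t)/D⌋ = a

div-+divisor : ∀ a d → (a +ℕ suc d) / suc d ≡ suc (a / suc d)
div-+divisor a d = trans (ℕD.m/n≡1+[m∸n]/n (ℕP.m≤n+m (suc d) a))
  (cong (λ z → suc (z / suc d)) (ℕP.m+n∸n≡m a (suc d)))

hermite : ∀ d a → ΣN.sum (λ (t : Fin (suc d)) → (a +ℕ toℕ t) / suc d) ≡ a
hermite d zero = trans (ΣN.sum-cong-≗ vanish) (ΣN.sum-replicate-zero (suc d))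
  where
  vanish : ∀ (t : Fin (suc d)) → toℕ t / suc d ≡ 0
  vanish t = ℕD.m<n⇒m/n≡0 (FinP.toℕ<n t)
hermite d (suc a) = begin
  ΣN.sum f                                     ≡⟨ ΣN.sum-init-last f ⟩
  ΣN.sum (λ t → f (inject₁ t)) +ℕ f (fromℕ d)  ≡⟨ cong₂ _+ℕ_ (ΣN.sum-cong-≗ shift) lastTerm ⟩
  S +ℕ suc ((a +ℕ 0) / suc d)                  ≡⟨ ℕP.+-suc S _ ⟩
  suc (S +ℕ (a +ℕ 0) / suc d)                  ≡⟨ cong suc (ℕP.+-comm S _) ⟩
  suc ((a +ℕ 0) / suc d +ℕ S)                  ≡⟨ cong suc (hermite d a) ⟩
  suc a                                        ∎
  where
  open ≡-Reasoning
  f : Fin (suc d) → ℕ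
  f t = (suc a +ℕ toℕ t) / suc d
  S = ΣN.sum (λ (t : Fin d) → (a +ℕ suc (toℕ t)) / suc d)
  shift : ∀ (t : Fin d) → f (inject₁ t) ≡ (a +ℕ suc (toℕ t)) / suc d
  shift t = trans (cong (λ z → (suc a +ℕ z) / suc d) (FinP.toℕ-inject₁ t))
                  (cong (_/ suc d) (sym (ℕP.+-suc a (toℕ t))))
  lastTerm : f (fromℕ d) ≡ suc ((a +ℕ 0) / suc d)
  lastTerm = begin
    (suc a +ℕ toℕ (fromℕ d)) / suc d ≡⟨ cong (λ z → (suc a +ℕ z) / suc d) (FinP.toℕ-fromℕ d) ⟩
    (suc a +ℕ d) / suc d             ≡⟨ cong (_/ suc d) (sym (ℕP.+-suc a d)) ⟩
    (a +ℕ suc d) / suc d             ≡⟨ div-+divisor a d ⟩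
    suc (a / suc d)                  ≡⟨ cong (λ z → suc (z / suc d)) (sym (ℕP.+-identityʳ a)) ⟩
    suc ((a +ℕ 0) / suc d)           ∎

-- Integral presentations of points of P(M[P,Q])

-- y = Σ_l (c_l/D) e_{B_l} with D = d+1 = Σ_l c_l and every B_l a basis of M[P,Q]
record Presentation {m r : ℕ} (P Q : Path m r) (y : Point (m +ℕ r)) : Set where
  constructor presentation
  field
    k       : ℕ
    Bs      : Fin k → Vec Bool (m +ℕ r)
    c       : Fin k → ℕ
    d       : ℕ
    bases   : ∀ l → IsBasis P Q (Bs l)
    weights : ΣN.sum c ≡ suc d
    coords  : ∀ i → y i ≡ frac (ΣN.sum (λ l → c l *ℕ bit (lookup (Bs l) i))) d

indicator-frac : ∀ {n} (B : Vec Bool n) i → indicator B i ≡ frac (bit (lookup B i)) 0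
indicator-frac B i with lookup B i
... | true  = refl
... | false = refl

commonDenominator : ∀ {k} (λs : Fin k → ℚ) → (∀ l → 0ℚ ≤ℚ λs l) →
  Σ ℕ λ d → Σ (Fin k → ℕ) λ c → ∀ l → λs l ≡ frac (c l) d
commonDenominator {zero}  λs nonneg = 0 , (λ ()) , (λ ())
commonDenominator {suc k} λs nonneg
  with nonneg⇒frac (λs zero) (nonneg zero) | commonDenominator (λ l → λs (suc l)) (λ l → nonneg (suc l))
... | a , e , λ₀≡ | d , c , λs≡ = d +ℕ e *ℕ suc d , c' , expand
  where
  c' : Fin (suc k) → ℕ
  c' zero    = a *ℕ suc d
  c' (suc l) = c l *ℕ suc e
  reorder₁ : ∀ a D E → a *ℕ (E *ℕ D) ≡ a *ℕ D *ℕ E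
  reorder₁ = solve-∀
  reorder₂ : ∀ a D E → a *ℕ (E *ℕ D) ≡ a *ℕ E *ℕ D
  reorder₂ = solve-∀
  expand : ∀ l → λs l ≡ frac (c' l) (d +ℕ e *ℕ suc d)
  expand zero    = trans λ₀≡ (frac-cong a e (a *ℕ suc d) _ (reorder₁ a (suc d) (suc e)))
  expand (suc l) = trans (λs≡ l) (frac-cong (c l) d (c l *ℕ suc e) _ (reorder₂ (c l) (suc d) (suc e)))

toPresentation : ∀ {m r} {P Q : Path m r} {y} → LPMPolytope P Q y → Presentation P Q y
toPresentation {y = y} (k , Bs , λs , bases , nonneg , Σλ≡1 , y≡) with commonDenominator λs nonneg
... | d , c , λs≡ = presentation k Bs c d bases weights coords
  where
  weights : ΣN.sum c ≡ suc d
  weights = trans (sym (ℕP.*-identityʳ (ΣN.sum c)))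
    (trans (frac-cross (ΣN.sum c) d 1 0 (trans (sym (sumℚ-frac d c)) (trans (sumℚ-cong (λ l → sym (λs≡ l))) Σλ≡1)))
    (ℕP.+-identityʳ (suc d)))
  coords : ∀ i → y i ≡ frac (ΣN.sum (λ l → c l *ℕ bit (lookup (Bs l) i))) d
  coords i = trans (y≡ i) (trans (sumℚ-cong (λ l → trans (cong₂ _*_ (λs≡ l) (indicator-frac (Bs l) i))
                                                      (frac-*-integer (c l) d _)))
    (sumℚ-frac d (λ l → c l *ℕ bit (lookup (Bs l) i))))

fromPresentation : ∀ {m r} {P Q : Path m r} {y} → Presentation P Q y → LPMPolytope P Q y
fromPresentation (presentation k Bs c d bases weights coords) =
  k , Bs , (λ l → frac (c l) d) , bases , (λ l → frac-mono 0 0 (c l) d z≤n) ,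
  trans (sumℚ-frac d c) (trans (cong (λ z → frac z d) weights) (frac-cong (suc d) d 1 0 (ℕP.*-comm (suc d) 1))) ,
  λ i → trans (coords i) (sym (trans (sumℚ-cong (λ l → trans (cong (frac (c l) d *_) (indicator-frac (Bs l) i))
                                                         (frac-*-integer (c l) d _)))
    (sumℚ-frac d (λ l → c l *ℕ bit (lookup (Bs l) i)))))

relax : ∀ {m r} {P Q P' Q' : Path m r} {y} →
  (∀ B → IsBasis P Q B → IsBasis P' Q' B) → Presentation P Q y → Presentation P' Q' y
relax include (presentation k Bs c d bases weights coords) =
  presentation k Bs c d (λ l → include (Bs l) (bases l)) weights coords

singleton : ∀ {m r} {P Q : Path m r} B → IsBasis P Q B → Presentation P Q (indicator B)
singleton B isB = presentation 1 (λ _ → B) (λ _ → 1) 0 (λ _ → isB) refl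
  (λ i → trans (indicator-frac B i)
    (cong (λ z → frac z 0) (sym (trans (ℕP.+-identityʳ (1 *ℕ bit (lookup B i))) (ℕP.*-identityˡ (bit (lookup B i)))))))

module Weighted {k : ℕ} (c : Fin k → ℕ) where

  wsum : (Fin k → ℕ) → ℕ
  wsum f = ΣN.sum (λ l → c l *ℕ f l)

  wsum-mono : ∀ {f g} → (∀ l → f l ≤ g l) → wsum f ≤ wsum g
  wsum-mono le = sumN-mono (λ l → ℕP.*-monoʳ-≤ (c l) (le l))

  wsum-+ : ∀ f g → wsum (λ l → f l +ℕ g l) ≡ wsum f +ℕ wsum g
  wsum-+ f g = trans (ΣN.sum-cong-≗ (λ l → ℕP.*-distribˡ-+ (c l) (f l) (g l)))
    (ΣN.∑-distrib-+ (λ l → c l *ℕ f l) (λ l → c l *ℕ g l))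

  wsum-const : ∀ v → wsum (λ _ → v) ≡ v *ℕ ΣN.sum c
  wsum-const = sumN-*const c

  wsum-lower : ∀ {f} v → (∀ l → v ≤ f l) → v *ℕ ΣN.sum c ≤ wsum f
  wsum-lower v le = subst (_≤ _) (wsum-const v) (wsum-mono le)

  wsum-upper : ∀ {f} v → (∀ l → f l ≤ v) → wsum f ≤ v *ℕ ΣN.sum c
  wsum-upper v le = subst (_ ≤_) (wsum-const v) (wsum-mono le)

-- The weighted height profile A(k) = Σ_l c_l · height(B_l, k) of a presentation;
-- it behaves like D times the height function of a lattice path.
module Profile {m r : ℕ} {P Q : Path m r} {y : Point (m +ℕ r)} (R : Presentation P Q y) where
  open Presentation R
  open Weighted c

  n : ℕ
  n = m +ℕ r

  A : ℕ → ℕ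
  A j = wsum (λ l → height (Bs l) j)

  A-lower : ∀ v j → (∀ l → v ≤ height (Bs l) j) → v *ℕ suc d ≤ A j
  A-lower v j le = subst (λ D → v *ℕ D ≤ A j) weights (wsum-lower v le)

  A-upper : ∀ v j → (∀ l → height (Bs l) j ≤ v) → A j ≤ v *ℕ suc d
  A-upper v j le = subst (λ D → A j ≤ v *ℕ D) weights (wsum-upper v le)

  A-lipschitz : ∀ j j' → A j' ≤ A j +ℕ (j' ∸ j) *ℕ suc d
  A-lipschitz j j' = ℕP.≤-trans
    (wsum-mono (λ l → unitStep-lipschitz (height-unitStep (Bs l)) j j'))
    (ℕP.≤-reflexive (trans (wsum-+ (λ l → height (Bs l) j) (λ _ → j' ∸ j))
      (cong (A j +ℕ_) (trans (wsum-const (j' ∸ j)) (cong ((j' ∸ j) *ℕ_) weights)))))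

  A-step : ∀ j → A j ≤ A (suc j) × A (suc j) ≤ A j +ℕ suc d
  A-step j = wsum-mono (λ l → proj₁ (height-unitStep (Bs l) j)) ,
    subst (λ t → A (suc j) ≤ A j +ℕ t) (trans (cong (_*ℕ suc d) (ℕP.m+n∸n≡m 1 j)) (ℕP.*-identityˡ (suc d)))
      (A-lipschitz j (suc j))

  A-⊓ : ∀ j → A j ≡ A (j ⊓ n)
  A-⊓ j = ΣN.sum-cong-≗ (λ l → cong (c l *ℕ_) (height-⊓ (Bs l) j))

  A-zero : A 0 ≡ 0
  A-zero = trans (ΣN.sum-cong-≗ (λ l → trans (cong (c l *ℕ_) (height-zero (Bs l))) (ℕP.*-zeroʳ (c l))))
    (ΣN.sum-replicate-zero k)

  A-end : A n ≡ r *ℕ suc d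
  A-end = trans (ΣN.sum-cong-≗ (λ l → cong (c l *ℕ_) (trans (height-end (Bs l) n ℕP.≤-refl) (proj₁ (bases l)))))
    (trans (wsum-const r) (cong (r *ℕ_) weights))

  -- the increment of A at position i is D·y_i
  A-increment : ∀ (i : Fin n) → A (suc (toℕ i)) ≡ ΣN.sum (λ l → c l *ℕ bit (lookup (Bs l) i)) +ℕ A (toℕ i)
  A-increment i = trans (ΣN.sum-cong-≗ (λ l → cong (c l *ℕ_) (height-step (Bs l) i)))
    (wsum-+ (λ l → bit (lookup (Bs l) i)) (λ l → height (Bs l) (toℕ i)))

prefix : ∀ {n} → ℕ → Point n
prefix x i = if toℕ i ℕ.<ᵇ x then 1ℚ else 0ℚ

prefix-count : ∀ {n} (B : Vec Bool n) x →
  ΣN.sum (λ i → bit (toℕ i ℕ.<ᵇ x) *ℕ bit (lookup B i)) ≡ height B x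
prefix-count []          x       = refl
prefix-count {suc n} (b ∷ B) zero = ΣN.sum-replicate-zero n
prefix-count (true ∷ B)  (suc x) = cong suc (prefix-count B x)
prefix-count (false ∷ B) (suc x) = prefix-count B x

select-frac : ∀ b a d → (if b then 1ℚ else 0ℚ) * frac a d ≡ frac (bit b *ℕ a) d
select-frac true  a d = trans (ℚP.*-identityˡ (frac a d)) (cong (λ z → frac z d) (sym (ℕP.+-identityʳ a)))
select-frac false a d = trans (ℚP.*-zeroˡ (frac a d)) (sym (frac-zero d))

prefix-profile : ∀ {m r} {P Q : Path m r} {y} (R : Presentation P Q y) x →
  dot (prefix x) y ≡ frac (Profile.A R x) (Presentation.d R)
prefix-profile {m} {r} {y = y} R@(presentation _ Bs c d _ _ coords) x = begin
  dot (prefix x) y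
    ≡⟨ sumℚ-cong (λ i → trans (cong (prefix x i *_) (coords i)) (select-frac (toℕ i ℕ.<ᵇ x) (N i) d)) ⟩
  sumℚ (λ i → frac (b i *ℕ N i) d)      ≡⟨ sumℚ-frac d (λ i → b i *ℕ N i) ⟩
  frac (ΣN.sum (λ i → b i *ℕ N i)) d    ≡⟨ cong (λ z → frac z d) counted ⟩
  frac (Profile.A R x) d                ∎
  where
  open ≡-Reasoning
  b : Fin (m +ℕ r) → ℕ
  b i = bit (toℕ i ℕ.<ᵇ x)
  N : Fin (m +ℕ r) → ℕ
  N i = ΣN.sum (λ l → c l *ℕ bit (lookup (Bs l) i))
  reorder : ∀ a c b → a *ℕ (c *ℕ b) ≡ c *ℕ (a *ℕ b)
  reorder = solve-∀
  counted : ΣN.sum (λ i → b i *ℕ N i) ≡ Profile.A R x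
  counted = begin
    ΣN.sum (λ i → b i *ℕ N i)
      ≡⟨ ΣN.sum-cong-≗ (λ i → trans (ΣN.*-distribˡ-sum (b i) (λ l → c l *ℕ bit (lookup (Bs l) i)))
                                     (ΣN.sum-cong-≗ (λ l → reorder (b i) (c l) (bit (lookup (Bs l) i))))) ⟩
    ΣN.sum (λ i → ΣN.sum (λ l → c l *ℕ (b i *ℕ bit (lookup (Bs l) i))))
      ≡⟨ ΣN.∑-comm (λ i l → c l *ℕ (b i *ℕ bit (lookup (Bs l) i))) ⟩
    ΣN.sum (λ l → ΣN.sum (λ i → c l *ℕ (b i *ℕ bit (lookup (Bs l) i))))
      ≡⟨ ΣN.sum-cong-≗ (λ l → trans (sym (ΣN.*-distribˡ-sum (c l) (λ i → b i *ℕ bit (lookup (Bs l) i))))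
                                     (cong (c l *ℕ_) (prefix-count (Bs l) x))) ⟩
    Profile.A R x ∎

-- The rounding theorem

div-exact : ∀ q t d → t < suc d → (q *ℕ suc d +ℕ t) / suc d ≡ q
div-exact q t d t<D = trans (ℕD.+-distrib-/-∣ˡ t (n∣m*n q))
  (trans (cong₂ _+ℕ_ (ℕD.m*n/n≡m q (suc d)) (ℕD.m<n⇒m/n≡0 t<D)) (ℕP.+-identityʳ q))

sum-ones : ∀ k → ΣN.sum {k} (λ _ → 1) ≡ k
sum-ones zero    = refl
sum-ones (suc k) = cong suc (sum-ones k)

-- If the profile of y lies between D·height(P') and D·height(Q'), then
-- y ∈ P(M[P',Q']): the D paths with heights ⌊(A + t)/D⌋, t < D, are bases
-- of M[P',Q'] whose average is y (Hermite's identity).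
module Rounding {m r : ℕ} {P Q : Path m r} {y : Point (m +ℕ r)} (R : Presentation P Q y) where
  open Presentation R
  open Profile R

  rounded : ℕ → ℕ → ℕ
  rounded t j = (A j +ℕ t) / suc d

  rounded-unitStep : ∀ t → UnitStep (rounded t)
  rounded-unitStep t j = ℕD./-monoˡ-≤ (suc d) (ℕP.+-monoˡ-≤ t (proj₁ (A-step j))) ,
    ℕP.≤-trans (ℕD./-monoˡ-≤ (suc d) (ℕP.≤-trans (ℕP.+-monoˡ-≤ t (proj₂ (A-step j)))
                                               (ℕP.≤-reflexive (swap (A j) (suc d) t))))
               (ℕP.≤-reflexive (div-+divisor (A j +ℕ t) d))
    where
    swap : ∀ a b t → a +ℕ b +ℕ t ≡ a +ℕ t +ℕ b
    swap = solve-∀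

  rounded-start : ∀ t → t < suc d → rounded t 0 ≡ 0
  rounded-start t t<D = trans (cong (λ z → (z +ℕ t) / suc d) A-zero) (ℕD.m<n⇒m/n≡0 t<D)

  rounded-end : ∀ t → t < suc d → rounded t n ≡ r
  rounded-end t t<D = trans (cong (λ z → (z +ℕ t) / suc d) A-end) (div-exact r t d t<D)

  rounded-⊓ : ∀ t j → rounded t (j ⊓ n) ≡ rounded t j
  rounded-⊓ t j = cong (λ z → (z +ℕ t) / suc d) (sym (A-⊓ j))

  rounded-between : ∀ t → t < suc d → ∀ j lo hi → lo *ℕ suc d ≤ A j → A j ≤ hi *ℕ suc d →
    lo ≤ rounded t j × rounded t j ≤ hi
  rounded-between t t<D j lo hi lo≤ ≤hi =
    ℕP.≤-trans (ℕP.≤-reflexive (sym (ℕD.m*n/n≡m lo (suc d))))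
               (ℕD./-monoˡ-≤ (suc d) (ℕP.≤-trans lo≤ (ℕP.m≤m+n (A j) t))) ,
    ℕP.≤-trans (ℕD./-monoˡ-≤ (suc d) (ℕP.+-monoˡ-≤ t ≤hi)) (ℕP.≤-reflexive (div-exact hi t d t<D))

  rounded-average : ∀ j → ΣN.sum (λ (t : Fin (suc d)) → rounded (toℕ t) j) ≡ A j
  rounded-average j = hermite d (A j)

  roundedPath : Fin (suc d) → Path m r
  roundedPath t = proj₁ (pathWithHeights m r (rounded (toℕ t)) (rounded-start (toℕ t) (FinP.toℕ<n t))
                           (rounded-unitStep (toℕ t)) (rounded-end (toℕ t) (FinP.toℕ<n t)))

  roundedPath-height : ∀ t j → height (proj₁ (roundedPath t)) j ≡ rounded (toℕ t) j
  roundedPath-height t j = trans (proj₂ (pathWithHeights m r (rounded (toℕ t)) (rounded-start (toℕ t) (FinP.toℕ<n t))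
                                           (rounded-unitStep (toℕ t)) (rounded-end (toℕ t) (FinP.toℕ<n t))) j)
                                 (rounded-⊓ (toℕ t) j)

  roundedWord : Fin (suc d) → Vec Bool n
  roundedWord t = proj₁ (roundedPath t)

  -- column i of the rounded paths sums to D·y_i:
  -- Σ_t bit(B_t,i) + A(i) = Σ_t rounded t (i+1) = A(i+1) = D·y_i + A(i)
  rounded-column : ∀ i → ΣN.sum (λ t → bit (lookup (roundedWord t) i)) ≡ ΣN.sum (λ l → c l *ℕ bit (lookup (Bs l) i))
  rounded-column i = ℕP.+-cancelʳ-≡ (A (toℕ i)) _ _ (begin
    column +ℕ A (toℕ i)                                  ≡⟨ cong (column +ℕ_) (sym (rounded-average (toℕ i))) ⟩
    column +ℕ Σt (λ t → rounded (toℕ t) (toℕ i))         ≡⟨ sym (ΣN.∑-distrib-+ bits (λ t → rounded (toℕ t) (toℕ i))) ⟩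
    Σt (λ t → bits t +ℕ rounded (toℕ t) (toℕ i))         ≡⟨ ΣN.sum-cong-≗ step ⟩
    Σt (λ t → rounded (toℕ t) (suc (toℕ i)))             ≡⟨ rounded-average (suc (toℕ i)) ⟩
    A (suc (toℕ i))                                      ≡⟨ A-increment i ⟩
    ΣN.sum (λ l → c l *ℕ bit (lookup (Bs l) i)) +ℕ A (toℕ i) ∎)
    where
    open ≡-Reasoning
    Σt : (Fin (suc d) → ℕ) → ℕ
    Σt = ΣN.sum
    bits : Fin (suc d) → ℕ
    bits t = bit (lookup (roundedWord t) i)
    column : ℕ
    column = Σt bits
    step : ∀ t → bits t +ℕ rounded (toℕ t) (toℕ i) ≡ rounded (toℕ t) (suc (toℕ i))
    step t = trans (cong (bits t +ℕ_) (sym (roundedPath-height t (toℕ i))))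
      (trans (sym (height-step (roundedWord t) i)) (roundedPath-height t (suc (toℕ i))))

  round : (P' Q' : Path m r) → (∀ j → height (proj₁ P') j *ℕ suc d ≤ A j) →
    (∀ j → A j ≤ height (proj₁ Q') j *ℕ suc d) → Presentation P' Q' y
  round P' Q' lower upper = presentation (suc d) roundedWord (λ _ → 1) d isBasis (sum-ones (suc d)) coords'
    where
    between : ∀ t j → height (proj₁ P') j ≤ rounded (toℕ t) j × rounded (toℕ t) j ≤ height (proj₁ Q') j
    between t j = rounded-between (toℕ t) (FinP.toℕ<n t) j _ _ (lower j) (upper j)
    isBasis : ∀ t → IsBasis P' Q' (roundedWord t)
    isBasis t = proj₂ (roundedPath t) ,
      (λ j → subst (height (proj₁ P') j ≤_) (sym (roundedPath-height t j)) (proj₁ (between t j))) ,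
      (λ j → subst (_≤ height (proj₁ Q') j) (sym (roundedPath-height t j)) (proj₂ (between t j)))
    coords' : ∀ i → y i ≡ frac (ΣN.sum (λ t → 1 *ℕ bit (lookup (roundedWord t) i))) d
    coords' i = trans (coords i) (cong (λ z → frac z d)
      (sym (trans (ΣN.sum-cong-≗ (λ t → ℕP.*-identityˡ (bit (lookup (roundedWord t) i)))) (rounded-column i))))

mixture-frac : ∀ n d b N → frac n n * frac b 0 + frac 1 n * frac N d ≡ frac (n *ℕ suc d *ℕ b +ℕ N) (d +ℕ n *ℕ suc d)
mixture-frac n d b N = begin
  frac n n * frac b 0 + frac 1 n * frac N d          ≡⟨ cong₂ _+_ (frac-*-integer n n b) (frac-* 1 n N d) ⟩
  frac (n *ℕ b) n + frac (1 *ℕ N) d'                 ≡⟨ frac-+ (n *ℕ b) n (1 *ℕ N) d' ⟩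
  frac (n *ℕ b *ℕ suc d' +ℕ 1 *ℕ N *ℕ suc n) (d' +ℕ n *ℕ suc d')
    ≡⟨ frac-cong (n *ℕ b *ℕ suc d' +ℕ 1 *ℕ N *ℕ suc n) (d' +ℕ n *ℕ suc d')
                 (n *ℕ suc d *ℕ b +ℕ N) d' (clear n d b N) ⟩
  frac (n *ℕ suc d *ℕ b +ℕ N) d'                     ∎
  where
  open ≡-Reasoning
  d' : ℕ
  d' = d +ℕ n *ℕ suc d
  clear : ∀ n d b N → (n *ℕ b *ℕ (suc n *ℕ suc d) +ℕ 1 *ℕ N *ℕ suc n) *ℕ (suc n *ℕ suc d)
      ≡ (n *ℕ suc d *ℕ b +ℕ N) *ℕ (suc n *ℕ (suc n *ℕ suc d))
  clear = solve-∀

mix : ∀ {m r} {P Q : Path m r} {p : Point (m +ℕ r)} (E : Vec Bool (m +ℕ r)) → IsBasis P Q E →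
  Presentation P Q p →
  Presentation P Q (λ i → frac (m +ℕ r) (m +ℕ r) * indicator E i + frac 1 (m +ℕ r) * p i)
mix {m} {r} {P} {Q} {p} E isE (presentation k Bs c d bases weights coords) =
  presentation (suc k) Bs' c' (d +ℕ n *ℕ suc d) bases' weights' coords'
  where
  n : ℕ
  n = m +ℕ r
  Bs' : Fin (suc k) → Vec Bool n
  Bs' zero    = E
  Bs' (suc l) = Bs l
  c' : Fin (suc k) → ℕ
  c' zero    = n *ℕ suc d
  c' (suc l) = c l
  bases' : ∀ l → IsBasis P Q (Bs' l)
  bases' zero    = isE
  bases' (suc l) = bases l
  weights' : n *ℕ suc d +ℕ ΣN.sum c ≡ suc (d +ℕ n *ℕ suc d)
  weights' = trans (cong (n *ℕ suc d +ℕ_) weights) (ℕP.+-comm (n *ℕ suc d) (suc d))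
  coords' : ∀ i → frac n n * indicator E i + frac 1 n * p i ≡
    frac (ΣN.sum (λ l → c' l *ℕ bit (lookup (Bs' l) i))) (d +ℕ n *ℕ suc d)
  coords' i = trans (cong₂ (λ u v → frac n n * u + frac 1 n * v) (indicator-frac E i) (coords i))
    (mixture-frac n d (bit (lookup E i)) (ΣN.sum (λ l → c l *ℕ bit (lookup (Bs l) i))))

mixture-below : ∀ n D h a j → suc h ≤ j → a ≤ n *ℕ D → n *ℕ D *ℕ h +ℕ a ≤ j *ℕ (suc n *ℕ D)
mixture-below n D h a j h<j a≤nD = begin
  n *ℕ D *ℕ h +ℕ a         ≤⟨ ℕP.+-monoʳ-≤ (n *ℕ D *ℕ h) a≤nD ⟩
  n *ℕ D *ℕ h +ℕ n *ℕ D    ≡⟨ collect (n *ℕ D) h ⟩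
  n *ℕ D *ℕ suc h          ≤⟨ ℕP.*-monoʳ-≤ (n *ℕ D) h<j ⟩
  n *ℕ D *ℕ j              ≡⟨ ℕP.*-comm (n *ℕ D) j ⟩
  j *ℕ (n *ℕ D)            ≤⟨ ℕP.*-monoʳ-≤ j (ℕP.m≤n+m (n *ℕ D) D) ⟩
  j *ℕ (suc n *ℕ D)        ∎
  where
  open ℕP.≤-Reasoning
  collect : ∀ a h → a *ℕ h +ℕ a ≡ a *ℕ suc h
  collect = solve-∀

mixture-above : ∀ n D h a j → j ≤ n → suc j ≤ h → j *ℕ (suc n *ℕ D) ≤ n *ℕ D *ℕ h +ℕ a
mixture-above n D h a j j≤n j<h = begin
  j *ℕ (suc n *ℕ D)        ≡⟨ expand j D n ⟩
  j *ℕ D +ℕ n *ℕ D *ℕ j    ≤⟨ ℕP.+-monoˡ-≤ (n *ℕ D *ℕ j) (ℕP.*-monoˡ-≤ D j≤n) ⟩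
  n *ℕ D +ℕ n *ℕ D *ℕ j    ≡⟨ collect (n *ℕ D) j ⟩
  n *ℕ D *ℕ suc j          ≤⟨ ℕP.*-monoʳ-≤ (n *ℕ D) j<h ⟩
  n *ℕ D *ℕ h              ≤⟨ ℕP.m≤m+n (n *ℕ D *ℕ h) a ⟩
  n *ℕ D *ℕ h +ℕ a         ∎
  where
  open ℕP.≤-Reasoning
  expand : ∀ j D n → j *ℕ (suc n *ℕ D) ≡ j *ℕ D +ℕ n *ℕ D *ℕ j
  expand = solve-∀
  collect : ∀ a j → a +ℕ a *ℕ j ≡ a *ℕ suc j
  collect = solve-∀

frac-inverse : ∀ n → frac (suc n) 0 * frac 1 n ≡ 1ℚ
frac-inverse n = trans (frac-* (suc n) 0 1 n) (frac-cong (suc n *ℕ 1) (n +ℕ 0 *ℕ suc n) 1 0 (cancel n))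
  where
  cancel : ∀ n → suc n *ℕ 1 *ℕ 1 ≡ 1 *ℕ suc (n +ℕ 0 *ℕ suc n)
  cancel = solve-∀

singleton-profile : ∀ {m r} {P Q : Path m r} B (isB : IsBasis P Q B) k →
  Profile.A (singleton {P = P} {Q} B isB) k ≡ height B k
singleton-profile B isB k = trans (ℕP.+-identityʳ (1 *ℕ height B k)) (ℕP.*-identityˡ (height B k))

mix-profile : ∀ {m r} {P Q : Path m r} {p : Point (m +ℕ r)} E (isE : IsBasis P Q E) (R : Presentation P Q p) k →
  Profile.A (mix E isE R) k ≡ (m +ℕ r) *ℕ suc (Presentation.d R) *ℕ height E k +ℕ Profile.A R k
mix-profile E isE (presentation _ _ _ _ _ _ _) k = refl

-- The split

record SplitPosition {m r : ℕ} (P Q : Path m r) (x j : ℕ) : Set where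
  field
    Q-reached    : suc j ≤ height (proj₁ Q) x
    P-below      : suc (height (proj₁ P) x) ≤ j
    P-below-next : height (proj₁ P) (suc x) ≤ j
    j<r          : suc j ≤ r

module Split {m r : ℕ} (P Q : Path m r) (P≤Q : NotAbove (proj₁ P) (proj₁ Q)) (x j : ℕ)
  (position : SplitPosition P Q x j) where

  open SplitPosition position
  open Equivalence

  n : ℕ
  n = m +ℕ r

  Pv Qv : Vec Bool n
  Pv = proj₁ P
  Qv = proj₁ Q

  -- Q cannot reach height j+1 in fewer than j+1 steps
  j≤x : j ≤ x
  j≤x = ℕP.≤-trans (ℕP.n≤1+n j) (ℕP.≤-trans Q-reached (height-≤-steps Qv x))

  height-P-end : height Pv n ≡ r
  height-P-end = trans (height-end Pv n ℕP.≤-refl) (proj₂ P)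

  height-Q-end : height Qv n ≡ r
  height-Q-end = trans (height-end Qv n ℕP.≤-refl) (proj₂ Q)

  ceiling floor : ℕ → ℕ
  ceiling k = j +ℕ (k ∸ x)
  floor   k = j ∸ (x ∸ k)

  -- P, hence the ceiling, still reaches height r at the end
  r≤ceiling-end : r ≤ ceiling n
  r≤ceiling-end = ℕP.≤-trans (ℕP.≤-reflexive (sym height-P-end))
    (ℕP.≤-trans (unitStep-lipschitz (height-unitStep Pv) (suc x) n)
      (ℕP.+-mono-≤ P-below-next (ℕP.∸-monoʳ-≤ n (ℕP.n≤1+n x))))

  Q₁-path : Σ (Path m r) λ L → ∀ k → height (proj₁ L) k ≡ height Qv (k ⊓ n) ⊓ ceiling (k ⊓ n)
  Q₁-path = pathWithHeights m r (λ k → height Qv k ⊓ ceiling k)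
    (cong (_⊓ ceiling 0) (height-zero Qv))
    (unitStep-⊓ (height-unitStep Qv) (unitStep-rise j x))
    (trans (cong (_⊓ ceiling n) height-Q-end) (ℕP.m≤n⇒m⊓n≡m r≤ceiling-end))

  P₁-path : Σ (Path m r) λ L → ∀ k → height (proj₁ L) k ≡ height Pv (k ⊓ n) ⊔ floor (k ⊓ n)
  P₁-path = pathWithHeights m r (λ k → height Pv k ⊔ floor k)
    (trans (cong (_⊔ floor 0) (height-zero Pv)) (ℕP.m≤n⇒m∸n≡0 j≤x))
    (unitStep-⊔ (height-unitStep Pv) (unitStep-reach j x))
    (trans (cong (_⊔ floor n) height-P-end)
      (ℕP.m≥n⇒m⊔n≡m (ℕP.≤-trans (ℕP.m∸n≤m j (x ∸ n)) (ℕP.≤-trans (ℕP.n≤1+n j) j<r))))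

  Q₁ P₁ : Path m r
  Q₁ = proj₁ Q₁-path
  P₁ = proj₁ P₁-path

  height-Q₁ : ∀ k → height (proj₁ Q₁) k ≡ height Qv (k ⊓ n) ⊓ ceiling (k ⊓ n)
  height-Q₁ = proj₂ Q₁-path

  height-P₁ : ∀ k → height (proj₁ P₁) k ≡ height Pv (k ⊓ n) ⊔ floor (k ⊓ n)
  height-P₁ = proj₂ P₁-path

  -- P stays under the ceiling and Q above the floor, so P ≤ Q₁ and P₁ ≤ Q
  P≤ceiling : ∀ k → height Pv k ≤ ceiling k
  P≤ceiling k = ℕP.≤-trans (unitStep-lipschitz (height-unitStep Pv) x k)
    (ℕP.+-monoˡ-≤ (k ∸ x) (ℕP.≤-trans (ℕP.n≤1+n _) P-below))

  floor≤Q : ∀ k → floor k ≤ height Qv k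
  floor≤Q k = ℕP.m≤n+o⇒m∸n≤o j (x ∸ k)
    (ℕP.≤-trans (ℕP.n≤1+n j) (ℕP.≤-trans Q-reached
      (ℕP.≤-trans (unitStep-lipschitz (height-unitStep Qv) k x) (ℕP.≤-reflexive (ℕP.+-comm (height Qv k) (x ∸ k))))))

  P≤Q₁ : NotAbove Pv (proj₁ Q₁)
  P≤Q₁ k = ℕP.≤-trans (ℕP.≤-reflexive (height-⊓ Pv k))
    (ℕP.≤-trans (ℕP.⊓-glb (P≤Q (k ⊓ n)) (P≤ceiling (k ⊓ n))) (ℕP.≤-reflexive (sym (height-Q₁ k))))

  P₁≤Q : NotAbove (proj₁ P₁) Qv
  P₁≤Q k = ℕP.≤-trans (ℕP.≤-reflexive (height-P₁ k))
    (ℕP.≤-trans (ℕP.⊔-lub (P≤Q (k ⊓ n)) (floor≤Q (k ⊓ n))) (ℕP.≤-reflexive (sym (height-⊓ Qv k))))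

  Q₁≤Q : NotAbove (proj₁ Q₁) Qv
  Q₁≤Q k = ℕP.≤-trans (ℕP.≤-reflexive (height-Q₁ k))
    (ℕP.≤-trans (ℕP.m⊓n≤m _ _) (ℕP.≤-reflexive (sym (height-⊓ Qv k))))

  P≤P₁ : NotAbove Pv (proj₁ P₁)
  P≤P₁ k = ℕP.≤-trans (ℕP.≤-reflexive (height-⊓ Pv k))
    (ℕP.≤-trans (ℕP.m≤m⊔n _ _) (ℕP.≤-reflexive (sym (height-P₁ k))))

  -- P has not finished after x+1 steps, so x lies inside the path
  x<n : x < n
  x<n = ℕP.≰⇒> λ n≤x → ℕP.<⇒≱ j<r (ℕP.≤-trans (ℕP.≤-reflexive
    (sym (trans (height-end Pv (suc x) (ℕP.m≤n⇒m≤1+n n≤x)) (proj₂ P)))) P-below-next)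

  -- at step x the new boundaries sit at height j: every basis of M[P,Q₁]
  -- is at most j there, every basis of M[P₁,Q] at least j
  Q₁-at-x : height (proj₁ Q₁) x ≤ j
  Q₁-at-x = ℕP.≤-trans (ℕP.≤-reflexive (height-Q₁ x)) (ℕP.≤-trans (ℕP.m⊓n≤n _ _)
    (ℕP.≤-reflexive (trans (cong (j +ℕ_) (ℕP.m≤n⇒m∸n≡0 (ℕP.m⊓n≤m x n))) (ℕP.+-identityʳ j))))

  P₁-at-x : j ≤ height (proj₁ P₁) x
  P₁-at-x = ℕP.≤-trans (ℕP.≤-reflexive (sym (trans (cong (λ z → j ∸ (x ∸ z)) (ℕP.m≤n⇒m⊓n≡m (ℕP.<⇒≤ x<n)))
                                                    (cong (j ∸_) (ℕP.n∸n≡0 x)))))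
    (ℕP.≤-trans (ℕP.m≤n⊔m _ _) (ℕP.≤-reflexive (sym (height-P₁ x))))

  S S₁ S₂ : PointSet n
  S  = LPMPolytope P Q
  S₁ = LPMPolytope P Q₁
  S₂ = LPMPolytope P₁ Q

  module Measure {P' Q' : Path m r} {y : Point n} (R : Presentation P' Q' y) where
    open Presentation R
    open Profile R hiding (n)

    below-j⇔ : dot (prefix x) y ≤ℚ frac j 0 ⇔ A x ≤ j *ℕ suc d
    below-j⇔ = subst (λ q → q ≤ℚ frac j 0 ⇔ A x ≤ j *ℕ suc d) (sym (prefix-profile R x)) (frac-≤-integer (A x) d j)

    above-j⇔ : frac j 0 ≤ℚ dot (prefix x) y ⇔ j *ℕ suc d ≤ A x
    above-j⇔ = subst (λ q → frac j 0 ≤ℚ q ⇔ j *ℕ suc d ≤ A x) (sym (prefix-profile R x)) (integer-≤-frac j (A x) d)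

  -- profiles of points of S lie between D·P and D·Q ...
  module Bounds {y : Point n} (R : Presentation P Q y) where
    open Presentation R
    open Profile R hiding (n)

    above-P : ∀ k → height Pv k *ℕ suc d ≤ A k
    above-P k = A-lower (height Pv k) k (λ l → proj₁ (proj₂ (bases l)) k)

    below-Q : ∀ k → A k ≤ height Qv k *ℕ suc d
    below-Q k = A-upper (height Qv k) k (λ l → proj₂ (proj₂ (bases l)) k)

    -- ... and since A grows by at most D per step, A(x) ≤ jD keeps A below D·Q₁
    below-Q₁ : A x ≤ j *ℕ suc d → ∀ k → A k ≤ height (proj₁ Q₁) k *ℕ suc d
    below-Q₁ Ax≤ k = begin
      A k                                           ≡⟨ A-⊓ k ⟩
      A k'                                          ≤⟨ ℕP.⊓-glb (below-Q k') ceiling-bound ⟩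
      (height Qv k' *ℕ suc d) ⊓ (ceiling k' *ℕ suc d) ≡⟨ sym (ℕP.*-distribʳ-⊓ (suc d) (height Qv k') (ceiling k')) ⟩
      (height Qv k' ⊓ ceiling k') *ℕ suc d          ≡⟨ cong (_*ℕ suc d) (sym (height-Q₁ k)) ⟩
      height (proj₁ Q₁) k *ℕ suc d                  ∎
      where
      open ℕP.≤-Reasoning
      k' = k ⊓ n
      ceiling-bound : A k' ≤ ceiling k' *ℕ suc d
      ceiling-bound = ℕP.≤-trans (A-lipschitz x k')
        (ℕP.≤-trans (ℕP.+-monoˡ-≤ _ Ax≤) (ℕP.≤-reflexive (sym (ℕP.*-distribʳ-+ (suc d) j (k' ∸ x)))))

    above-P₁ : j *ℕ suc d ≤ A x → ∀ k → height (proj₁ P₁) k *ℕ suc d ≤ A k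
    above-P₁ ≤Ax k = begin
      height (proj₁ P₁) k *ℕ suc d                  ≡⟨ cong (_*ℕ suc d) (height-P₁ k) ⟩
      (height Pv k' ⊔ floor k') *ℕ suc d            ≡⟨ ℕP.*-distribʳ-⊔ (suc d) (height Pv k') (floor k') ⟩
      (height Pv k' *ℕ suc d) ⊔ (floor k' *ℕ suc d) ≤⟨ ℕP.⊔-lub (above-P k') floor-bound ⟩
      A k'                                          ≡⟨ sym (A-⊓ k) ⟩
      A k                                           ∎
      where
      open ℕP.≤-Reasoning
      k' = k ⊓ n
      floor-bound : floor k' *ℕ suc d ≤ A k'
      floor-bound = ℕP.≤-trans (ℕP.≤-reflexive (ℕP.*-distribʳ-∸ (suc d) j (x ∸ k')))
        (ℕP.m≤n+o⇒m∸n≤o (j *ℕ suc d) ((x ∸ k') *ℕ suc d)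
          (ℕP.≤-trans ≤Ax (ℕP.≤-trans (A-lipschitz k' x) (ℕP.≤-reflexive (ℕP.+-comm (A k') _)))))

  present : ∀ {y} → S y → Presentation P Q y
  present = toPresentation
  present₁ : ∀ {y} → S₁ y → Presentation P Q₁ y
  present₁ = toPresentation
  present₂ : ∀ {y} → S₂ y → Presentation P₁ Q y
  present₂ = toPresentation

  S₁-half : ∀ y → S₁ y ⇔ (S y × dot (prefix x) y ≤ℚ frac j 0)
  S₁-half y = mk⇔
    (λ s₁ → let R = present₁ s₁ in
      fromPresentation (relax {P = P} {Q₁} {P} {Q} narrower R) ,
      from (Measure.below-j⇔ R)
        (Profile.A-upper R j x (λ l → ℕP.≤-trans (proj₂ (proj₂ (Presentation.bases R l)) x) Q₁-at-x)))
    (λ { (s , le) → let R = present s in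
      fromPresentation (Rounding.round R P Q₁ (Bounds.above-P R) (Bounds.below-Q₁ R (to (Measure.below-j⇔ R) le))) })
    where
    narrower : ∀ B → IsBasis P Q₁ B → IsBasis P Q B
    narrower B (numN≡ , P≤B , B≤Q₁) = numN≡ , P≤B , (λ k → ℕP.≤-trans (B≤Q₁ k) (Q₁≤Q k))

  S₂-half : ∀ y → S₂ y ⇔ (S y × frac j 0 ≤ℚ dot (prefix x) y)
  S₂-half y = mk⇔
    (λ s₂ → let R = present₂ s₂ in
      fromPresentation (relax {P = P₁} {Q} {P} {Q} narrower R) ,
      from (Measure.above-j⇔ R)
        (Profile.A-lower R j x (λ l → ℕP.≤-trans P₁-at-x (proj₁ (proj₂ (Presentation.bases R l)) x))))
    (λ { (s , le) → let R = present s in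
      fromPresentation (Rounding.round R P₁ Q (Bounds.above-P₁ R (to (Measure.above-j⇔ R) le)) (Bounds.below-Q R)) })
    where
    narrower : ∀ B → IsBasis P₁ Q B → IsBasis P Q B
    narrower B (numN≡ , P₁≤B , B≤Q) = numN≡ , (λ k → ℕP.≤-trans (P≤P₁ k) (P₁≤B k)) , B≤Q

  open HalfSpaceSplit S S₁ S₂ (prefix x) (frac j 0) S₁-half S₂-half

  basis-P : IsBasis P Q Pv
  basis-P = proj₂ P , (λ k → ℕP.≤-refl) , P≤Q

  basis-Q : IsBasis P Q Qv
  basis-Q = proj₂ Q , P≤Q , (λ k → ℕP.≤-refl)

  e-P : Presentation P Q (indicator Pv)
  e-P = singleton Pv basis-P

  e-Q : Presentation P Q (indicator Qv)
  e-Q = singleton Qv basis-Q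

  -- e_Q lies strictly above the hyperplane, e_P strictly below
  proper₁ : ProperSubset S₁ S
  proper₁ = indicator Qv , fromPresentation e-Q , λ s₁ →
    ℕP.<⇒≱ Q-reached (subst₂ _≤_ (singleton-profile {P = P} {Q} Qv basis-Q x) (ℕP.*-identityʳ j)
      (to (Measure.below-j⇔ e-Q) (proj₂ (to (S₁-half (indicator Qv)) s₁))))

  proper₂ : ProperSubset S₂ S
  proper₂ = indicator Pv , fromPresentation e-P , λ s₂ →
    ℕP.<⇒≱ P-below (subst₂ _≤_ (ℕP.*-identityʳ j) (singleton-profile {P = P} {Q} Pv basis-P x)
      (to (Measure.above-j⇔ e-P) (proj₂ (to (S₂-half (indicator Pv)) s₂))))

  -- the contraction y ↦ (n·e + y)/(n+1) towards e = e_P lands in S₁, towards e = e_Q in S₂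
  contract : Point n → Point n → Point n
  contract e y i = frac n n * e i + frac 1 n * y i

  -- every basis has at most r ≤ n North steps
  profile-≤-nD : ∀ {y} (R : Presentation P Q y) → Profile.A R x ≤ n *ℕ suc (Presentation.d R)
  profile-≤-nD R = ℕP.≤-trans
    (Profile.A-upper R r x (λ l → ℕP.≤-trans (height-≤-numN (Presentation.Bs R l) x)
                                            (ℕP.≤-reflexive (proj₁ (Presentation.bases R l)))))
    (ℕP.*-monoˡ-≤ (suc (Presentation.d R)) (ℕP.m≤n+m r m))

  contract-into₁ : ∀ y → S y → S₁ (contract (indicator Pv) y)
  contract-into₁ y s = from (S₁-half _) (fromPresentation R' , from (Measure.below-j⇔ R') bound)
    where
    R : Presentation P Q y
    R = present s
    R' : Presentation P Q (contract (indicator Pv) y)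
    R' = mix Pv basis-P R
    bound : Profile.A R' x ≤ j *ℕ suc (Presentation.d R')
    bound = subst (_≤ j *ℕ suc (Presentation.d R')) (sym (mix-profile Pv basis-P R x))
      (mixture-below n (suc (Presentation.d R)) (height Pv x) (Profile.A R x) j P-below (profile-≤-nD R))

  contract-into₂ : ∀ y → S y → S₂ (contract (indicator Qv) y)
  contract-into₂ y s = from (S₂-half _) (fromPresentation R' , from (Measure.above-j⇔ R') bound)
    where
    R : Presentation P Q y
    R = present s
    R' : Presentation P Q (contract (indicator Qv) y)
    R' = mix Qv basis-Q R
    j≤n : j ≤ n
    j≤n = ℕP.≤-trans (ℕP.n≤1+n j) (ℕP.≤-trans j<r (ℕP.m≤n+m r m))
    bound : j *ℕ suc (Presentation.d R') ≤ Profile.A R' x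
    bound = subst (j *ℕ suc (Presentation.d R') ≤_) (sym (mix-profile Qv basis-Q R x))
      (mixture-above n (suc (Presentation.d R)) (height Qv x) (Profile.A R x) j j≤n Q-reached)

  dim₁ : SameDim S₁ S
  dim₁ = sameDim-byContraction S S₁ (indicator Pv) (frac n n) (frac 1 n) (frac (suc n) 0) (frac-inverse n)
    (λ y s₁ → proj₁ (to (S₁-half y) s₁)) contract-into₁

  dim₂ : SameDim S₂ S
  dim₂ = sameDim-byContraction S S₂ (indicator Qv) (frac n n) (frac 1 n) (frac (suc n) 0) (frac-inverse n)
    (λ y s₂ → proj₁ (to (S₂-half y) s₂)) contract-into₂

  nontrivialSplit : NontrivialHyperplaneSplit S S₁ S₂
  nontrivialSplit = (covers , dim₁ , dim₂ , face-below , face-above) , proper₁ , proper₂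

reached-by : ∀ {n} (v : Vec Bool n) i k → 1 ≤ i → i ≤ numN v → northPos v i ≤ k → i ≤ height v k
reached-by v i k 1≤i i≤N pos≤k =
  ℕP.≤-trans (northPos-reached v i 1≤i i≤N) (unitStep-mono (height-unitStep v) pos≤k)

not-yet-reached : ∀ {n} (v : Vec Bool n) i k → 1 ≤ i → k < northPos v i → height v k < i
not-yet-reached v i k 1≤i k<pos = ℕP.≰⇒> (λ i≤h → ℕP.<⇒≱ k<pos (northPos-first v i k 1≤i i≤h))

splitPosition : ∀ {m r} (P Q : Path m r) (x j : ℕ) → 1 ≤ j → j ≤ r ∸ 1 →
  x < northPos (proj₁ P) j → northPos (proj₁ Q) (j +ℕ 1) < x +ℕ 1 → x +ℕ 1 < northPos (proj₁ P) (j +ℕ 1) →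
  SplitPosition P Q x j
splitPosition {r = r} P Q x j 1≤j j≤r-1 x<tⱼ sⱼ₊₁<x+1 x+1<tⱼ₊₁ = record
  { Q-reached    = subst (_≤ height (proj₁ Q) x) j+1≡
      (reached-by (proj₁ Q) (j +ℕ 1) x 1≤j+1 (subst (_≤ numN (proj₁ Q)) (sym j+1≡) (subst (suc j ≤_) (sym (proj₂ Q)) j<r))
                  (ℕP.≤-pred (subst (suc (northPos (proj₁ Q) (j +ℕ 1)) ≤_) x+1≡ sⱼ₊₁<x+1)))
  ; P-below      = not-yet-reached (proj₁ P) j x 1≤j x<tⱼ
  ; P-below-next = ℕP.≤-pred (subst₂ (λ k i → height (proj₁ P) k < i) x+1≡ j+1≡
      (not-yet-reached (proj₁ P) (j +ℕ 1) (x +ℕ 1) 1≤j+1 x+1<tⱼ₊₁))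
  ; j<r          = j<r
  }
  where
  j+1≡ : j +ℕ 1 ≡ suc j
  j+1≡ = ℕP.+-comm j 1
  x+1≡ : x +ℕ 1 ≡ suc x
  x+1≡ = ℕP.+-comm x 1
  1≤j+1 : 1 ≤ j +ℕ 1
  1≤j+1 = ℕP.≤-trans 1≤j (ℕP.m≤m+n j 1)
  j<r : suc j ≤ r
  j<r = below-pred r j≤r-1
    where
    below-pred : ∀ r → j ≤ r ∸ 1 → suc j ≤ r
    below-pred zero    j≤0 = ⊥-elim (ℕP.<⇒≱ 1≤j j≤0)
    below-pred (suc r) j≤r = s≤s j≤r

-- s_j < x only serves to make x non-negative; the other three inequalities locate the split
mainTheorem7 : ∀ (m r : ℕ) (P Q : Path m r) → NotAbove (proj₁ P) (proj₁ Q) →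
    (x : ℤ) (j : ℕ) → 1 ≤ j → j ≤ r ∸ 1 →
    (+ northPos (proj₁ Q) j) <ℤ x → x <ℤ (+ northPos (proj₁ P) j) →
    (+ northPos (proj₁ Q) (j +ℕ 1)) <ℤ (x +ℤ + 1) → (x +ℤ + 1) <ℤ (+ northPos (proj₁ P) (j +ℕ 1)) →
    Σ (Path m r) λ P₁ → Σ (Path m r) λ Q₁ →
      NotAbove (proj₁ P) (proj₁ Q₁) × NotAbove (proj₁ P₁) (proj₁ Q) ×
      NontrivialHyperplaneSplit (LPMPolytope P Q) (LPMPolytope P Q₁) (LPMPolytope P₁ Q)
mainTheorem7 m r P Q P≤Q -[1+ x ] j _ _ () _ _ _
mainTheorem7 m r P Q P≤Q (+ x) j 1≤j j≤r-1 _ (ℤ.+<+ x<tⱼ) (ℤ.+<+ sⱼ₊₁<x+1) (ℤ.+<+ x+1<tⱼ₊₁) =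
  P₁ , Q₁ , P≤Q₁ , P₁≤Q , nontrivialSplit
  where
  open Split P Q P≤Q x j (splitPosition P Q x j 1≤j j≤r-1 x<tⱼ sⱼ₊₁<x+1 x+1<tⱼ₊₁)
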